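{- Let $G=(V,E)$ be a multigraph with $|V|=s\geq 2$ vertices, and let $v\in V$. Suppose that $\deg(v)\geq 1$ and $\deg(u)\geq 3$ for all $u\in V\setminus\{v\}$. Then $G$ contains a path $(p_1,p_2,\dots,p_k)$ and a cycle $(c_1,c_2,\dots,c_\ell)$ such that $p_1=v$, $p_k=c_1$, $k\geq 1$, $\ell\geq 1$, and $k+\ell\leq 4\log(s)$.
   Context: A multigraph may contain parallel edges and (possibly parallel) self-loops. The degree of a vertex is the number of incident edges, where a self-loop contributes two to the degree. A path $(p_1,\dots,p_k)$ has $k$ vertices. A cycle $(c_1,\dots,c_\ell)$ has $\ell$ vertices; a cycle with $\ell=1$ is a self-loop, and a cycle with $\ell=2$ is a pair of parallel edges between two vertices. Logarithms are base $2$. -}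

module Defs where

open import Data.Nat using (ℕ; zero; suc; _+_)
open import Data.Nat.DivMod using (_mod_)
open import Data.Fin using (Fin; toℕ; inject₁; _≟_)
open import Data.List using (List; map; allFin)
open import Data.Nat.ListAction using (sum)
open import Data.Product using (Σ; _×_; _,_; proj₁; proj₂)
open import Data.Sum using (_⊎_)
open import Relation.Nullary.Decidable using (does)
open import Data.Bool using (if_then_else_)
open import Relation.Binary.PropositionalEquality using (_≡_)
open import Function.Definitions using (Injective)

-- A finite multigraph on vertex set Fin s: m edges, edge e has endpoints ends e.
-- Parallel edges (distinct e with same endpoints) and self-loops (ends e = (x , x))
-- are allowed.
record Multigraph (s : ℕ) : Set where
  field
    m    : ℕ
    ends : Fin m → Fin s × Fin s
open Multigraph public

Joins : ∀ {s} (G : Multigraph s) → Fin (m G) → Fin s → Fin s → Set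
Joins G e x y = ends G e ≡ (x , y) ⊎ ends G e ≡ (y , x)

δ : ∀ {s} → Fin s → Fin s → ℕ
δ a b = if does (a ≟ b) then 1 else 0

-- degree: each edge contributes one per endpoint equal to u (self-loop counts 2)
deg : ∀ {s} (G : Multigraph s) → Fin s → ℕ
deg G u = sum (map (λ e → δ (proj₁ (ends G e)) u + δ (proj₂ (ends G e)) u) (allFin (m G)))

-- A path (p_1,...,p_k) with k = suc k': distinct vertices, consecutive ones adjacent.
IsPath : ∀ {s} (G : Multigraph s) (k' : ℕ) → (Fin (suc k') → Fin s) → Set
IsPath G k' p =
  Injective _≡_ _≡_ p ×
  ((i : Fin k') → Σ (Fin (m G)) λ e → Joins G e (p (inject₁ i)) (p (Fin.suc i)))

cycSuc : ∀ {n} → Fin (suc n) → Fin (suc n)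
cycSuc {n} i = suc (toℕ i) mod (suc n)

-- A cycle (c_1,...,c_ℓ) with ℓ = suc ℓ': distinct vertices, and distinct edges
-- f i joining c_i and c_{i+1} (indices mod ℓ).  ℓ = 1: a self-loop;
-- ℓ = 2: two distinct parallel edges.
IsCycle : ∀ {s} (G : Multigraph s) (ℓ' : ℕ) → (Fin (suc ℓ') → Fin s) → Set
IsCycle G ℓ' c =
  Injective _≡_ _≡_ c ×
  Σ (Fin (suc ℓ') → Fin (m G)) λ f →
    Injective _≡_ _≡_ f × ((i : Fin (suc ℓ')) → Joins G (f i) (c i) (c (cycSuc i)))

-- Explore the non-backtracking walks from v as a binary tree. The root sits at v and has
-- one child, reached along some edge at v; every other node leaves its vertex along two
-- edges different from the one it arrived by, which exist as long as the walk has not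
-- returned to v, since all other vertices have degree at least 3. The two exits use
-- different edges unless the first is a self-loop, so short cycles come out as self-loops
-- or as pairs of distinct parallel edges.
-- List the nodes in breadth-first order and stop at the first node N whose vertex was
-- already visited, by a node i. The nodes before N carry distinct vertices and contain the
-- whole tree of depth D = depth N - 1, which has 2^D nodes, so 2^D ≤ s. The path runs from
-- v down to the deepest common ancestor of N and i, and the cycle goes from there down to
-- N and back up from i. This gives k + ℓ ≤ 2D + 2, and 2^(2D+2) ≤ 4s² ≤ s⁴.

module Submission where

open import Defs
open import Data.Bool using (Bool; true; false; if_then_else_)
open import Data.Empty using (⊥-elim)
open import Data.Fin using (Fin; zero; suc; toℕ; fromℕ; _≟_)
open import Data.Fin.Properties using (toℕ-fromℕ<; toℕ-injective; toℕ<n; toℕ-inject₁; toℕ-fromℕ; injective⇒≤)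
open import Data.List using (List; []; _∷_; _++_; [_]; map; length; lookup; tabulate; allFin; filter)
open import Data.List.Properties using (++-identityʳ; ++-assoc; map-tabulate; length-++; length-map)
open import Data.List.Membership.Propositional using (_∈_; _∉_; lose; find)
open import Data.List.Membership.Propositional.Properties
  using (∈-++⁻; ∈-++⁺ˡ; ∈-++⁺ʳ; ∈-map⁺; ∈-map⁻; ∈-lookup; ∈-allFin; ∈-filter⁺; ∈-filter⁻)
open import Data.List.Relation.Unary.All as All using (All; []; _∷_)
open import Data.List.Relation.Unary.All.Properties using (++⁻ʳ)
open import Data.List.Relation.Unary.AllPairs as AllPairs using (AllPairs; []; _∷_)
import Data.List.Relation.Unary.AllPairs.Properties as AllPairs
import Data.List.Relation.Unary.Unique.Propositional.Properties as Unique
open import Data.List.Relation.Unary.Any using (Any; here; there; any?)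
open import Data.List.Relation.Unary.Unique.Propositional using (Unique)
open import Data.Nat using (ℕ; zero; suc; _+_; _*_; _∸_; _^_; _≤_; _<_; z≤n; s≤s; s≤s⁻¹)
open import Data.Nat.DivMod using (_%_; m<n⇒m%n≡m; n%n≡0)
open import Data.Nat.ListAction using (sum)
open import Data.Nat.Properties hiding (_≟_)
open import Algebra.Properties.CommutativeSemigroup +-commutativeSemigroup using (x∙yz≈y∙xz)
open import Data.Product using (Σ; _×_; _,_; proj₁; proj₂)
open import Data.Sum using (_⊎_; inj₁; inj₂; [_,_]′; swap; map₂)
open import Function.Base using (_∘_; id; case_of_)
open import Function.Definitions using (Injective)
open import Relation.Binary.Definitions using (DecidableEquality)
open import Relation.Binary.PropositionalEquality hiding ([_])
open import Relation.Nullary using (¬_; yes; no; does; _×-dec_; map′)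
open import Relation.Unary using (Decidable)

module _ {A B : Set} where

  InjectiveOn : (A → B) → List A → Set
  InjectiveOn f xs = ∀ {a a′} → a ∈ xs → a′ ∈ xs → f a ≡ f a′ → a ≡ a′

  record FirstRepeat (f : A → B) (xs : List A) : Set where
    field
      before    : List A
      repeated  : A
      after     : List A
      split     : xs ≡ before ++ repeated ∷ after
      injective : InjectiveOn f before
      earlier   : Any (λ a → f a ≡ f repeated) before

  first-repeat : DecidableEquality B → (f : A → B) (xs : List A) → InjectiveOn f xs ⊎ FirstRepeat f xs
  first-repeat _≟B_ f xs = scan [] xs (λ ()) refl
    where
    scan : ∀ seen rest → InjectiveOn f seen → xs ≡ seen ++ rest → InjectiveOn f xs ⊎ FirstRepeat f xs
    scan seen [] inj eq = inj₁ (subst (InjectiveOn f) (sym (trans eq (++-identityʳ seen))) inj)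
    scan seen (y ∷ rest) inj eq with any? (λ a → f a ≟B f y) seen
    ... | yes repeated = inj₂ record
      { before = seen ; repeated = y ; after = rest ; split = eq ; injective = inj ; earlier = repeated }
    ... | no fresh = scan (seen ++ [ y ]) rest inj′ (trans eq (sym (++-assoc seen [ y ] rest)))
      where
      inj′ : InjectiveOn f (seen ++ [ y ])
      inj′ a∈ a′∈ e with ∈-++⁻ seen a∈ | ∈-++⁻ seen a′∈
      ... | inj₁ a∈s | inj₁ a′∈s = inj a∈s a′∈s e
      ... | inj₁ a∈s | inj₂ (here refl) = ⊥-elim (fresh (lose a∈s e))
      ... | inj₂ (here refl) | inj₁ a′∈s = ⊥-elim (fresh (lose a′∈s (sym e)))
      ... | inj₂ (here refl) | inj₂ (here refl) = refl

lookup-injective : ∀ {A : Set} {xs : List A} → Unique xs → Injective _≡_ _≡_ (lookup xs)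
lookup-injective {xs = x ∷ xs} (x∉ ∷ u) {zero} {zero} _ = refl
lookup-injective {xs = x ∷ xs} (x∉ ∷ u) {zero} {suc j} eq = ⊥-elim (All.lookup x∉ (∈-lookup j) eq)
lookup-injective {xs = x ∷ xs} (x∉ ∷ u) {suc i} {zero} eq = ⊥-elim (All.lookup x∉ (∈-lookup i) (sym eq))
lookup-injective {xs = x ∷ xs} (x∉ ∷ u) {suc i} {suc j} eq = cong suc (lookup-injective u eq)

InjectiveOn⇒length≤ : ∀ {A : Set} {n} {f : A → Fin n} {xs} → Unique xs → InjectiveOn f xs → length xs ≤ n
InjectiveOn⇒length≤ u inj = injective⇒≤ λ eq → lookup-injective u (inj (∈-lookup _) (∈-lookup _) eq)

AllPairs-++⁻ : ∀ {A : Set} {R : A → A → Set} xs {ys} → AllPairs R (xs ++ ys) →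
  All (λ x → All (R x) ys) xs × AllPairs R ys
AllPairs-++⁻ [] rys = [] , rys
AllPairs-++⁻ (x ∷ xs) (rx ∷ rxys) = ++⁻ʳ xs rx ∷ proj₁ (AllPairs-++⁻ xs rxys) , proj₂ (AllPairs-++⁻ xs rxys)

greatest-≤ : ∀ {P : ℕ → Set} → Decidable P → P 0 → ∀ n →
  Σ ℕ λ L → L ≤ n × P L × (∀ {t} → L < t → t ≤ n → ¬ P t)
greatest-≤ P? p0 zero = 0 , z≤n , p0 , λ L<t t≤0 → ⊥-elim (<⇒≱ L<t t≤0)
greatest-≤ P? p0 (suc n) with P? (suc n)
... | yes pn = suc n , ≤-refl , pn , λ L<t t≤n → ⊥-elim (<⇒≱ L<t t≤n)
... | no ¬pn with greatest-≤ P? p0 n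
...   | L , L≤n , pL , above = L , m≤n⇒m≤1+n L≤n , pL , λ {t} L<t t≤1+n →
          [ (λ t<1+n → above L<t (s≤s⁻¹ t<1+n)) , (λ { refl → ¬pn }) ]′ (m≤n⇒m<n∨m≡n t≤1+n)

sum-map-mono : ∀ {A : Set} {g h : A → ℕ} → (∀ a → g a ≤ h a) → ∀ xs → sum (map g xs) ≤ sum (map h xs)
sum-map-mono g≤h [] = z≤n
sum-map-mono g≤h (x ∷ xs) = +-mono-≤ (g≤h x) (sum-map-mono g≤h xs)

sum-tabulate-0 : ∀ {n} (g : Fin n → ℕ) → (∀ f → g f ≡ 0) → sum (tabulate g) ≡ 0
sum-tabulate-0 {zero} g g≡0 = refl
sum-tabulate-0 {suc n} g g≡0 = cong₂ _+_ (g≡0 zero) (sum-tabulate-0 (λ f → g (suc f)) (λ f → g≡0 (suc f)))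

sum-tabulate-remove : ∀ {n} (g : Fin n → ℕ) e →
  sum (tabulate g) ≡ g e + sum (tabulate (λ f → if does (f ≟ e) then 0 else g f))
sum-tabulate-remove g zero = refl
sum-tabulate-remove g (suc e) = begin
  g zero + sum (tabulate (λ f → g (suc f)))                    ≡⟨ cong (g zero +_) (sum-tabulate-remove (λ f → g (suc f)) e) ⟩
  g zero + (g (suc e) + sum (tabulate (λ f → if does (f ≟ e) then 0 else g (suc f))))
                                                              ≡⟨ x∙yz≈y∙xz (g zero) (g (suc e)) _ ⟩
  g (suc e) + (g zero + sum (tabulate (λ f → if does (f ≟ e) then 0 else g (suc f)))) ∎
  where open ≡-Reasoning

sum-tabulate-≤ : ∀ {n} (g : Fin n → ℕ) (E : List (Fin n)) → (∀ f → f ∉ E → g f ≡ 0) →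
  sum (tabulate g) ≤ sum (map g E)
sum-tabulate-≤ g [] off = ≤-reflexive (sum-tabulate-0 g λ f → off f λ ())
sum-tabulate-≤ g (e ∷ E) off = begin
  sum (tabulate g)             ≡⟨ sum-tabulate-remove g e ⟩
  g e + sum (tabulate g-e)     ≤⟨ +-monoʳ-≤ (g e) (sum-tabulate-≤ g-e E off-E) ⟩
  g e + sum (map g-e E)        ≤⟨ +-monoʳ-≤ (g e) (sum-map-mono g-e≤g E) ⟩
  g e + sum (map g E)          ∎
  where
  open ≤-Reasoning
  g-e : Fin _ → ℕ
  g-e f = if does (f ≟ e) then 0 else g f
  g-e≤g : ∀ f → g-e f ≤ g f
  g-e≤g f with f ≟ e
  ... | yes _ = z≤n
  ... | no _ = ≤-refl
  off-E : ∀ f → f ∉ E → g-e f ≡ 0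
  off-E f f∉E with f ≟ e
  ... | yes _ = refl
  ... | no f≢e = off f λ { (here f≡e) → f≢e f≡e ; (there f∈E) → f∉E f∈E }

m+n≡1 : ∀ {m n} → m + n ≡ 1 → (m ≡ 0 × n ≡ 1) ⊎ (m ≡ 1 × n ≡ 0)
m+n≡1 {zero} eq = inj₁ (refl , eq)
m+n≡1 {suc zero} {zero} _ = inj₂ (refl , refl)

n<2^n : ∀ n → n < 2 ^ n
n<2^n zero = s≤s z≤n
n<2^n (suc n) = begin-strict
  suc n            ≡⟨ +-comm 1 n ⟩
  n + 1            <⟨ +-mono-<-≤ (n<2^n n) (m^n>0 2 n) ⟩
  2 ^ n + 2 ^ n    ≡⟨ cong (2 ^ n +_) (+-identityʳ _) ⟨
  2 ^ suc n        ∎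
  where open ≤-Reasoning

2^≤s^4 : ∀ {s D n} → 2 ≤ s → 2 ^ D ≤ s → n ≤ 2 + (D + D) → 2 ^ n ≤ s ^ 4
2^≤s^4 {s} {D} {n} 2≤s 2^D≤s n≤ = begin
  2 ^ n                  ≤⟨ ^-monoʳ-≤ 2 n≤ ⟩
  2 ^ (2 + (D + D))      ≡⟨ ^-distribˡ-+-* 2 2 (D + D) ⟩
  4 * 2 ^ (D + D)        ≡⟨ cong (4 *_) (^-distribˡ-+-* 2 D D) ⟩
  4 * (2 ^ D * 2 ^ D)    ≤⟨ *-mono-≤ (*-mono-≤ 2≤s 2≤s) (*-mono-≤ 2^D≤s 2^D≤s) ⟩
  s * s * (s * s)        ≡⟨ cong₂ _*_ s*s≡s^2 s*s≡s^2 ⟩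
  s ^ 2 * s ^ 2          ≡⟨ ^-distribˡ-+-* s 2 2 ⟨
  s ^ 4                  ∎
  where
  open ≤-Reasoning
  s*s≡s^2 : s * s ≡ s ^ 2
  s*s≡s^2 = cong (s *_) (sym (*-identityʳ s))

InjectiveBelow : ∀ {A : Set} → ℕ → (ℕ → A) → Set
InjectiveBelow k f = ∀ {j j′} → j < k → j′ < k → f j ≡ f j′ → j ≡ j′

n≤m<n+o⇒m∸n<o : ∀ {m n o} → n ≤ m → m < n + o → m ∸ n < o
n≤m<n+o⇒m∸n<o {m} {n} {o} n≤m m<n+o = +-cancelˡ-< n _ _ (subst (_< n + o) (sym (m+[n∸m]≡n n≤m)) m<n+o)

splice : ∀ {A : Set} → ℕ → (ℕ → A) → (ℕ → A) → ℕ → A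
splice k f g j with j <? k
... | yes _ = f j
... | no _ = g (j ∸ k)

module _ {A : Set} {k : ℕ} {f g : ℕ → A} where

  splice-< : ∀ {j} → j < k → splice k f g j ≡ f j
  splice-< {j} j<k with j <? k
  ... | yes _ = refl
  ... | no j≮k = ⊥-elim (j≮k j<k)

  splice-≥ : ∀ {j} → k ≤ j → splice k f g j ≡ g (j ∸ k)
  splice-≥ {j} k≤j with j <? k
  ... | yes j<k = ⊥-elim (<⇒≱ j<k k≤j)
  ... | no _ = refl

toℕ-cycSuc-< : ∀ {n} (i : Fin (suc n)) → suc (toℕ i) < suc n → toℕ (cycSuc i) ≡ suc (toℕ i)
toℕ-cycSuc-< i lt = trans (toℕ-fromℕ< _) (m<n⇒m%n≡m lt)

toℕ-cycSuc-last : ∀ {n} (i : Fin (suc n)) → toℕ i ≡ n → toℕ (cycSuc i) ≡ 0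
toℕ-cycSuc-last {n} i i≡n = trans (toℕ-fromℕ< _) (trans (cong (λ t → suc t % suc n) i≡n) (n%n≡0 (suc n)))

cycSuc-last-or-< : ∀ {n} (i : Fin (suc n)) → toℕ i ≡ n ⊎ suc (toℕ i) < suc n
cycSuc-last-or-< i = swap (map₂ suc-injective (m≤n⇒m<n∨m≡n (toℕ<n i)))

cycSuc²≢id : ∀ {n} → 2 ≤ n → (j : Fin (suc n)) → cycSuc (cycSuc j) ≢ j
cycSuc²≢id {n} 2≤n j eq with cycSuc-last-or-< j | cycSuc-last-or-< (cycSuc j)
... | inj₁ j≡n | inj₁ j′≡n =
  <⇒≢ (<-trans (n<1+n 0) 2≤n) (trans (sym (toℕ-cycSuc-last j j≡n)) j′≡n)
... | inj₁ j≡n | inj₂ j′< = <⇒≢ 2≤n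
  (trans (cong suc (sym (toℕ-cycSuc-last j j≡n))) (trans (sym (toℕ-cycSuc-< _ j′<)) (trans (cong toℕ eq) j≡n)))
... | inj₂ j< | inj₁ j′≡n = <⇒≢ 2≤n
  (trans (cong suc (trans (sym (toℕ-cycSuc-last _ j′≡n)) (cong toℕ eq))) (trans (sym (toℕ-cycSuc-< j j<)) j′≡n))
... | inj₂ j< | inj₂ j′< = <⇒≢ (<-trans (n<1+n _) (n<1+n _))
  (trans (cong toℕ (sym eq)) (trans (toℕ-cycSuc-< _ j′<) (cong suc (toℕ-cycSuc-< j j<))))

-- Walks

module _ {s : ℕ} (G : Multigraph s) where

  Joins-sym : ∀ {e x y} → Joins G e x y → Joins G e y x
  Joins-sym (inj₁ p) = inj₂ p
  Joins-sym (inj₂ p) = inj₁ p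

  Joins-unique : ∀ {e x y x′ y′} → Joins G e x y → Joins G e x′ y′ → (x ≡ x′ × y ≡ y′) ⊎ (x ≡ y′ × y ≡ x′)
  Joins-unique (inj₁ p) (inj₁ q) = inj₁ (cong proj₁ (trans (sym p) q) , cong proj₂ (trans (sym p) q))
  Joins-unique (inj₂ p) (inj₂ q) = inj₁ (cong proj₂ (trans (sym p) q) , cong proj₁ (trans (sym p) q))
  Joins-unique (inj₁ p) (inj₂ q) = inj₂ (cong proj₁ (trans (sym p) q) , cong proj₂ (trans (sym p) q))
  Joins-unique (inj₂ p) (inj₁ q) = inj₂ (cong proj₂ (trans (sym p) q) , cong proj₁ (trans (sym p) q))

  record Walk (k : ℕ) : Set where
    field
      vertex : ℕ → Fin s
      edge   : ℕ → Fin (m G)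
      joins  : ∀ {j} → j < k → Joins G (edge j) (vertex j) (vertex (suc j))
  open Walk public

  reverse : ∀ {k} → Walk k → Walk k
  reverse {k} w = record
    { vertex = λ j → vertex w (k ∸ j)
    ; edge   = λ j → edge w (k ∸ suc j)
    ; joins  = λ {j} j<k → Joins-sym (subst (λ t → Joins G (edge w (k ∸ suc j)) (vertex w (k ∸ suc j)) (vertex w t))
                                             (sym (+-∸-assoc 1 j<k)) (joins w (∸-monoʳ-< (s≤s z≤n) j<k)))
    }

  append : ∀ {k₁ k₂} (w₁ : Walk k₁) (w₂ : Walk k₂) → vertex w₁ k₁ ≡ vertex w₂ 0 → Walk (k₁ + k₂)
  append {k₁} {k₂} w₁ w₂ meet = record
    { vertex = splice k₁ (vertex w₁) (vertex w₂)
    ; edge   = splice k₁ (edge w₁) (edge w₂)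
    ; joins  = joins′
    }
    where
    joins′ : ∀ {j} → j < k₁ + k₂ →
      Joins G (splice k₁ (edge w₁) (edge w₂) j)
              (splice k₁ (vertex w₁) (vertex w₂) j) (splice k₁ (vertex w₁) (vertex w₂) (suc j))
    joins′ {j} j< with j <? k₁
    ... | no j≮k₁ = subst (Joins G (edge w₂ (j ∸ k₁)) (vertex w₂ (j ∸ k₁)))
                          (sym (trans (splice-≥ (m≤n⇒m≤1+n k₁≤j)) (cong (vertex w₂) (+-∸-assoc 1 k₁≤j))))
                          (joins w₂ (n≤m<n+o⇒m∸n<o k₁≤j j<))
      where k₁≤j = ≮⇒≥ j≮k₁
    ... | yes j<k₁ with m≤n⇒m<n∨m≡n j<k₁
    ...   | inj₁ 1+j<k₁ = subst (Joins G (edge w₁ j) (vertex w₁ j)) (sym (splice-< 1+j<k₁)) (joins w₁ j<k₁)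
    ...   | inj₂ 1+j≡k₁ = subst (Joins G (edge w₁ j) (vertex w₁ j)) (trans (cong (vertex w₁) 1+j≡k₁) (trans meet enter))
                                (joins w₁ j<k₁)
      where
      enter : vertex w₂ 0 ≡ splice k₁ (vertex w₁) (vertex w₂) (suc j)
      enter = sym (trans (splice-≥ (≤-reflexive (sym 1+j≡k₁))) (cong (vertex w₂) (m≤n⇒m∸n≡0 (≤-reflexive 1+j≡k₁))))

  walk⇒IsPath : ∀ {k} (w : Walk k) → InjectiveBelow (suc k) (vertex w) → IsPath G k (λ j → vertex w (toℕ j))
  walk⇒IsPath w inj =
    (λ eq → toℕ-injective (inj (toℕ<n _) (toℕ<n _) eq)) ,
    λ j → edge w (toℕ j) ,
          subst (λ t → Joins G (edge w (toℕ j)) (vertex w t) (vertex w (suc (toℕ j))))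
                (sym (toℕ-inject₁ j)) (joins w (toℕ<n j))

  cycle-edges-injective : ∀ {ℓ′} (c : Fin (suc ℓ′) → Fin s) (f : ℕ → Fin (m G)) →
    Injective _≡_ _≡_ c → (∀ i → Joins G (f (toℕ i)) (c i) (c (cycSuc i))) →
    (ℓ′ ≡ 1 → f 0 ≢ f 1) → Injective _≡_ _≡_ (f ∘ toℕ {suc ℓ′})
  cycle-edges-injective {zero} c f _ _ _ {zero} {zero} _ = refl
  cycle-edges-injective {suc zero} c f _ _ _ {zero} {zero} _ = refl
  cycle-edges-injective {suc zero} c f _ _ two {zero} {suc zero} e = ⊥-elim (two refl e)
  cycle-edges-injective {suc zero} c f _ _ two {suc zero} {zero} e = ⊥-elim (two refl (sym e))
  cycle-edges-injective {suc zero} c f _ _ _ {suc zero} {suc zero} _ = refl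
  cycle-edges-injective {suc (suc _)} c f c-inj J _ {i} {j} e
    with Joins-unique (J i) (subst (λ e′ → Joins G e′ (c j) (c (cycSuc j))) (sym e) (J j))
  ... | inj₁ (ci≡cj , _) = c-inj ci≡cj
  ... | inj₂ (ci≡cj′ , ci′≡cj) =
    ⊥-elim (cycSuc²≢id (s≤s (s≤s z≤n)) j (trans (cong cycSuc (sym (c-inj ci≡cj′))) (c-inj ci′≡cj)))

  closed-walk⇒IsCycle : ∀ {ℓ′} (w : Walk (suc ℓ′)) → vertex w (suc ℓ′) ≡ vertex w 0 →
    InjectiveBelow (suc ℓ′) (vertex w) → (ℓ′ ≡ 1 → edge w 0 ≢ edge w 1) →
    IsCycle G ℓ′ (λ j → vertex w (toℕ j))
  closed-walk⇒IsCycle {ℓ′} w closed inj two-edges =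
    c-inj , f ∘ toℕ , cycle-edges-injective c f c-inj joins-c two-edges , joins-c
    where
    c : Fin (suc ℓ′) → Fin s
    c j = vertex w (toℕ j)
    f : ℕ → Fin (m G)
    f = edge w
    c-inj : Injective _≡_ _≡_ c
    c-inj eq = toℕ-injective (inj (toℕ<n _) (toℕ<n _) eq)
    joins-c : ∀ i → Joins G (f (toℕ i)) (c i) (c (cycSuc i))
    joins-c i = subst (Joins G (f (toℕ i)) (c i)) next (joins w (toℕ<n i))
      where
      next : vertex w (suc (toℕ i)) ≡ c (cycSuc i)
      next with cycSuc-last-or-< i
      ... | inj₁ i≡ℓ′ = trans (cong (vertex w ∘ suc) i≡ℓ′)
                              (trans closed (cong (vertex w) (sym (toℕ-cycSuc-last i i≡ℓ′))))
      ... | inj₂ i< = cong (vertex w) (sym (toℕ-cycSuc-< i i<))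

  append-injective : ∀ {k₁ k₂} (w₁ : Walk k₁) (w₂ : Walk k₂) (meet : vertex w₁ k₁ ≡ vertex w₂ 0) →
    InjectiveBelow k₁ (vertex w₁) → InjectiveBelow k₂ (vertex w₂) →
    (∀ {j j′} → j < k₁ → j′ < k₂ → vertex w₁ j ≢ vertex w₂ j′) →
    InjectiveBelow (k₁ + k₂) (vertex (append w₁ w₂ meet))
  append-injective {k₁} w₁ w₂ meet inj-w₁ inj-w₂ apart {j} {j′} j< j′< eq with j <? k₁ | j′ <? k₁
  ... | yes j<k₁ | yes j′<k₁ = inj-w₁ j<k₁ j′<k₁ eq
  ... | yes j<k₁ | no j′≮k₁ = ⊥-elim (apart j<k₁ (n≤m<n+o⇒m∸n<o (≮⇒≥ j′≮k₁) j′<) eq)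
  ... | no j≮k₁ | yes j′<k₁ = ⊥-elim (apart j′<k₁ (n≤m<n+o⇒m∸n<o (≮⇒≥ j≮k₁) j<) (sym eq))
  ... | no j≮k₁ | no j′≮k₁ = ∸-cancelʳ-≡ (≮⇒≥ j≮k₁) (≮⇒≥ j′≮k₁)
    (inj-w₂ (n≤m<n+o⇒m∸n<o (≮⇒≥ j≮k₁) j<) (n≤m<n+o⇒m∸n<o (≮⇒≥ j′≮k₁) j′<) eq)

-- Leaving a vertex

module Exits {s : ℕ} (G : Multigraph s) where

  open import Data.List.Membership.DecPropositional (_≟_ {m G}) using (_∉?_)

  ends-at : Fin s → Fin (m G) → ℕ
  ends-at x f = δ (proj₁ (ends G f)) x + δ (proj₂ (ends G f)) x

  deg-tabulate : ∀ x → deg G x ≡ sum (tabulate (ends-at x))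
  deg-tabulate x = cong sum (map-tabulate id (ends-at x))

  other : Fin s → Fin (m G) → Fin s
  other x f = if does (proj₁ (ends G f) ≟ x) then proj₂ (ends G f) else proj₁ (ends G f)

  Exit : Fin s → List (Fin (m G)) → Fin (m G) → Set
  Exit x E f = f ∉ E × 1 ≤ ends-at x f

  exit? : ∀ x E → Decidable (Exit x E)
  exit? x E f = (f ∉? E) ×-dec (1 ≤? ends-at x f)

  exits : Fin s → List (Fin (m G)) → List (Fin (m G))
  exits x E = filter (exit? x E) (allFin (m G))

  no-exit⇒deg≤ : ∀ x E → exits x E ≡ [] → deg G x ≤ sum (map (ends-at x) E)
  no-exit⇒deg≤ x E none = begin
    deg G x                        ≡⟨ deg-tabulate x ⟩
    sum (tabulate (ends-at x))     ≤⟨ sum-tabulate-≤ (ends-at x) E unused ⟩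
    sum (map (ends-at x) E)        ∎
    where
    open ≤-Reasoning
    unused : ∀ f → f ∉ E → ends-at x f ≡ 0
    unused f f∉E with ends-at x f in eq
    ... | zero = refl
    ... | suc _ with () ← subst (f ∈_) none
                           (∈-filter⁺ (exit? x E) (∈-allFin f)
                                      (f∉E , subst (1 ≤_) (sym eq) (s≤s z≤n)))

  leave : Fin s → List (Fin (m G)) → Fin s × Fin (m G) → Fin s × Fin (m G)
  leave x E d with exits x E
  ... | [] = d
  ... | f ∷ _ = other x f , f

  leave-spec : ∀ x E d →
    (Σ (Fin (m G)) λ f → leave x E d ≡ (other x f , f) × Exit x E f) ⊎
    (leave x E d ≡ d × deg G x ≤ sum (map (ends-at x) E))
  leave-spec x E d with exits x E in eq
  ... | [] = inj₂ (refl , no-exit⇒deg≤ x E eq)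
  ... | f ∷ _ = inj₁ (f , refl ,
    proj₂ (∈-filter⁻ (exit? x E) {xs = allFin (m G)} (subst (f ∈_) (sym eq) (here refl))))

  ends-at≤2 : ∀ x f → ends-at x f ≤ 2
  ends-at≤2 x f = +-mono-≤ (δ≤1 (proj₁ (ends G f)) x) (δ≤1 (proj₂ (ends G f)) x)
    where
    δ≤1 : ∀ a b → δ a b ≤ 1
    δ≤1 a b with a ≟ b
    ... | yes _ = ≤-refl
    ... | no _ = z≤n

  Joins⇒ends-at≡1 : ∀ {f w x} → Joins G f w x → w ≢ x → ends-at x f ≡ 1
  Joins⇒ends-at≡1 {f} {w} {x} (inj₁ p) w≢x rewrite p with w ≟ x | x ≟ x
  ... | no _ | yes _ = refl
  ... | yes w≡x | _ = ⊥-elim (w≢x w≡x)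
  ... | _ | no x≢x = ⊥-elim (x≢x refl)
  Joins⇒ends-at≡1 {f} {w} {x} (inj₂ p) w≢x rewrite p with x ≟ x | w ≟ x
  ... | yes _ | no _ = refl
  ... | _ | yes w≡x = ⊥-elim (w≢x w≡x)
  ... | no x≢x | _ = ⊥-elim (x≢x refl)

  Joins-other : ∀ x f → 1 ≤ ends-at x f → Joins G f x (other x f)
  Joins-other x f pos with proj₁ (ends G f) ≟ x | proj₂ (ends G f) ≟ x
  ... | yes p | _ = inj₁ (cong (_, proj₂ (ends G f)) p)
  ... | no _ | yes q = inj₂ (cong (proj₁ (ends G f) ,_) q)
  ... | no _ | no _ = ⊥-elim (<-irrefl refl pos)

  other-loop : ∀ x f → 2 ≤ ends-at x f → other x f ≡ x
  other-loop x f two with proj₁ (ends G f) ≟ x | proj₂ (ends G f) ≟ x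
  ... | yes _ | yes q = q
  ... | yes _ | no _ = ⊥-elim (<-irrefl refl two)
  ... | no _ | yes _ = ⊥-elim (<-irrefl refl two)
  ... | no _ | no _ = ⊥-elim (<-irrefl refl (≤-trans (s≤s z≤n) two))

-- Addresses in a binary tree

data Branch : Set where
  top : Branch
  _▷_ : Branch → Bool → Branch

data Node : Set where
  root  : Node
  below : Branch → Node

height : Branch → ℕ
height top = 0
height (β ▷ _) = suc (height β)

depth : Node → ℕ
depth root = 0
depth (below β) = suc (height β)

parent : Node → Node
parent root = root
parent (below top) = root
parent (below (β ▷ _)) = below β

up : ℕ → Node → Node
up zero a = a
up (suc n) a = parent (up n a)

ancestor : Node → ℕ → Node
ancestor a t = up (depth a ∸ t) a

depth-parent : ∀ a → depth (parent a) ≡ depth a ∸ 1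
depth-parent root = refl
depth-parent (below top) = refl
depth-parent (below (β ▷ _)) = refl

depth-up : ∀ n a → depth (up n a) ≡ depth a ∸ n
depth-up zero a = refl
depth-up (suc n) a = trans (depth-parent (up n a)) (trans (cong (_∸ 1) (depth-up n a)) (pred[m∸n]≡m∸[1+n] (depth a) n))

depth-ancestor : ∀ {a t} → t ≤ depth a → depth (ancestor a t) ≡ t
depth-ancestor {a} {t} t≤ = trans (depth-up (depth a ∸ t) a) (m∸[m∸n]≡n t≤)

ancestor-depth : ∀ a → ancestor a (depth a) ≡ a
ancestor-depth a = cong (λ n → up n a) (n∸n≡0 (depth a))

depth≡0 : ∀ {a} → depth a ≡ 0 → a ≡ root
depth≡0 {root} _ = refl

depth≡1 : ∀ {a} → depth a ≡ 1 → a ≡ below top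
depth≡1 {below top} _ = refl
depth≡1 {below (_ ▷ _)} ()

ancestor-0 : ∀ a → ancestor a 0 ≡ root
ancestor-0 a = depth≡0 (depth-ancestor {a} z≤n)

ancestor-1 : ∀ {a} → 1 ≤ depth a → ancestor a 1 ≡ below top
ancestor-1 1≤ = depth≡1 (depth-ancestor 1≤)

parent-ancestor : ∀ {a t} → t < depth a → parent (ancestor a (suc t)) ≡ ancestor a t
parent-ancestor {a} {t} t< = cong (λ n → up n a) (sym (+-∸-assoc 1 t<))

▷-injective : ∀ {β β′ b b′} → β ▷ b ≡ β′ ▷ b′ → β ≡ β′ × b ≡ b′
▷-injective refl = refl , refl

below-injective : ∀ {β β′} → below β ≡ below β′ → β ≡ β′
below-injective refl = refl

_≟ᵇ_ : DecidableEquality Branch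
top ≟ᵇ top = yes refl
top ≟ᵇ (_ ▷ _) = no λ ()
(_ ▷ _) ≟ᵇ top = no λ ()
(β ▷ b) ≟ᵇ (β′ ▷ b′) = map′
  (λ (p , q) → cong₂ _▷_ p q) ▷-injective ((β ≟ᵇ β′) ×-dec (b Data.Bool.≟ b′))

_≟ₙ_ : DecidableEquality Node
root ≟ₙ root = yes refl
root ≟ₙ below _ = no λ ()
below _ ≟ₙ root = no λ ()
below β ≟ₙ below β′ = map′ (cong below) below-injective (β ≟ᵇ β′)

siblings : ∀ {a a′} → parent a ≡ parent a′ → depth a ≡ depth a′ → a ≢ a′ →
  Σ Branch λ β → parent a ≡ below β ×
    ((a ≡ below (β ▷ false) × a′ ≡ below (β ▷ true)) ⊎ (a ≡ below (β ▷ true) × a′ ≡ below (β ▷ false)))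
siblings {root} {root} _ _ a≢a′ = ⊥-elim (a≢a′ refl)
siblings {below top} {below top} _ _ a≢a′ = ⊥-elim (a≢a′ refl)
siblings {below (β ▷ false)} {below (.β ▷ true)} refl _ _ = β , refl , inj₁ (refl , refl)
siblings {below (β ▷ true)} {below (.β ▷ false)} refl _ _ = β , refl , inj₂ (refl , refl)
siblings {below (β ▷ false)} {below (.β ▷ false)} refl _ a≢a′ = ⊥-elim (a≢a′ refl)
siblings {below (β ▷ true)} {below (.β ▷ true)} refl _ a≢a′ = ⊥-elim (a≢a′ refl)

branches : ℕ → List Branch
branches zero = [ top ]
branches (suc t) = map (_▷ false) (branches t) ++ map (_▷ true) (branches t)

level : ℕ → List Node
level zero = [ root ]
level (suc t) = map below (branches t)

bfs : ℕ → List Node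
bfs zero = level zero
bfs (suc D) = bfs D ++ level (suc D)

length-branches : ∀ t → length (branches t) ≡ 2 ^ t
length-branches zero = refl
length-branches (suc t) = begin
  length (map (_▷ false) (branches t) ++ map (_▷ true) (branches t))     ≡⟨ length-++ (map (_▷ false) (branches t)) ⟩
  length (map (_▷ false) (branches t)) + length (map (_▷ true) (branches t))
                                                                       ≡⟨ cong₂ _+_ (length-map _ (branches t)) (length-map _ (branches t)) ⟩
  length (branches t) + length (branches t)                             ≡⟨ cong₂ _+_ (length-branches t) (trans (length-branches t) (sym (+-identityʳ _))) ⟩
  2 ^ t + (2 ^ t + 0)                                                   ∎
  where open ≡-Reasoning

length-bfs : ∀ D → length (bfs D) ≡ 2 ^ D
length-bfs zero = refl
length-bfs (suc D) = begin
  length (bfs D ++ level (suc D))                   ≡⟨ length-++ (bfs D) ⟩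
  length (bfs D) + length (map below (branches D))  ≡⟨ cong₂ _+_ (length-bfs D) (trans (length-map below (branches D)) (length-branches D)) ⟩
  2 ^ D + 2 ^ D                                     ≡⟨ cong (2 ^ D +_) (+-identityʳ _) ⟨
  2 ^ suc D                                         ∎
  where open ≡-Reasoning

∈-branches⁻ : ∀ {β t} → β ∈ branches t → height β ≡ t
∈-branches⁻ {t = zero} (here refl) = refl
∈-branches⁻ {t = suc t} β∈ with ∈-++⁻ (map (_▷ false) (branches t)) β∈
... | inj₁ β∈ˡ with ∈-map⁻ (_▷ false) β∈ˡ
...   | _ , γ∈ , refl = cong suc (∈-branches⁻ γ∈)
∈-branches⁻ {t = suc t} β∈ | inj₂ β∈ʳ with ∈-map⁻ (_▷ true) β∈ʳ
...   | _ , γ∈ , refl = cong suc (∈-branches⁻ γ∈)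

∈-branches⁺ : ∀ β → β ∈ branches (height β)
∈-branches⁺ top = here refl
∈-branches⁺ (β ▷ false) = ∈-++⁺ˡ (∈-map⁺ (_▷ false) (∈-branches⁺ β))
∈-branches⁺ (β ▷ true) = ∈-++⁺ʳ (map (_▷ false) (branches (height β))) (∈-map⁺ (_▷ true) (∈-branches⁺ β))

unique-branches : ∀ t → Unique (branches t)
unique-branches zero = [] ∷ []
unique-branches (suc t) = Unique.++⁺ (Unique.map⁺ (proj₁ ∘ ▷-injective) (unique-branches t))
                                     (Unique.map⁺ (proj₁ ∘ ▷-injective) (unique-branches t)) apart
  where
  apart : ∀ {β} → ¬ (β ∈ map (_▷ false) (branches t) × β ∈ map (_▷ true) (branches t))
  apart (β∈ˡ , β∈ʳ) with ∈-map⁻ (_▷ false) β∈ˡ | ∈-map⁻ (_▷ true) β∈ʳ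
  ... | _ , _ , refl | _ , _ , ()

∈-level⁻ : ∀ {a t} → a ∈ level t → depth a ≡ t
∈-level⁻ {t = zero} (here refl) = refl
∈-level⁻ {t = suc t} a∈ with ∈-map⁻ below a∈
... | _ , β∈ , refl = cong suc (∈-branches⁻ β∈)

∈-level⁺ : ∀ a → a ∈ level (depth a)
∈-level⁺ root = here refl
∈-level⁺ (below β) = ∈-map⁺ below (∈-branches⁺ β)

∈-bfs⁻ : ∀ {a} D → a ∈ bfs D → depth a ≤ D
∈-bfs⁻ zero a∈ = ≤-reflexive (∈-level⁻ a∈)
∈-bfs⁻ (suc D) a∈ with ∈-++⁻ (bfs D) a∈
... | inj₁ a∈bfs = m≤n⇒m≤1+n (∈-bfs⁻ D a∈bfs)
... | inj₂ a∈lvl = ≤-reflexive (∈-level⁻ a∈lvl)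

∈-bfs⁺ : ∀ {a} D → depth a ≤ D → a ∈ bfs D
∈-bfs⁺ {a} zero d≤ = subst (λ t → a ∈ level t) (n≤0⇒n≡0 d≤) (∈-level⁺ a)
∈-bfs⁺ {a} (suc D) d≤ with m≤n⇒m<n∨m≡n d≤
... | inj₁ d< = ∈-++⁺ˡ (∈-bfs⁺ D (s≤s⁻¹ d<))
... | inj₂ d≡ = ∈-++⁺ʳ (bfs D) (subst (λ t → a ∈ level t) d≡ (∈-level⁺ a))

Precedes : Node → Node → Set
Precedes a b = depth a ≤ depth b × a ≢ b

level-ordered : ∀ t → AllPairs Precedes (level t)
level-ordered t = AllPairs.zip (same-depth (level t) (All.tabulate ∈-level⁻) , unique t)
  where
  same-depth : ∀ as → All (λ a → depth a ≡ t) as → AllPairs (λ a b → depth a ≤ depth b) as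
  same-depth [] [] = []
  same-depth (a ∷ as) (da ∷ das) = All.map (λ db → ≤-reflexive (trans da (sym db))) das ∷ same-depth as das
  unique : ∀ t → Unique (level t)
  unique zero = [] ∷ []
  unique (suc t) = Unique.map⁺ below-injective (unique-branches t)

bfs-ordered : ∀ D → AllPairs Precedes (bfs D)
bfs-ordered zero = level-ordered zero
bfs-ordered (suc D) = AllPairs.++⁺ (bfs-ordered D) (level-ordered (suc D))
  (All.tabulate λ a∈ → All.tabulate λ b∈ →
    let a<b = s≤s (∈-bfs⁻ D a∈) in
    <⇒≤ (subst (_ <_) (sym (∈-level⁻ b∈)) a<b) ,
    λ { refl → <-irrefl (∈-level⁻ b∈) a<b })

-- The exploration tree

module Exploration {s : ℕ} (G : Multigraph s) (v : Fin s)
                   (deg-v : 1 ≤ deg G v) (deg-others : ∀ u → u ≢ v → 3 ≤ deg G u) where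

  open Exits G

  State : Set
  State = Fin s × Fin (m G)

  e₀ : Fin (m G)
  e₀ = inhabited (ends-at v) (subst (1 ≤_) (deg-tabulate v) deg-v)
    where
    inhabited : ∀ {n} (g : Fin n → ℕ) → 1 ≤ sum (tabulate g) → Fin n
    inhabited {suc n} _ _ = zero

  -- secondExit falls back to the first exit when x has no other edge left; by
  -- siblings-exits-differ this happens only when the first exit is a self-loop.
  firstExit secondExit : State → State
  firstExit (x , e) = leave x [ e ] (x , e)
  secondExit (x , e) = leave x (proj₂ (firstExit (x , e)) ∷ [ e ]) (firstExit (x , e))

  branchState : Branch → State
  branchState top = leave v [] (v , e₀)
  branchState (β ▷ false) = firstExit (branchState β)
  branchState (β ▷ true) = secondExit (branchState β)

  state : Node → State
  state root = v , e₀
  state (below β) = branchState β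

  vert : Node → Fin s
  vert a = proj₁ (state a)

  incoming : Node → Fin (m G)
  incoming a = proj₂ (state a)

  back : Node → List (Fin (m G))
  back root = []
  back (below β) = [ incoming (below β) ]

  -- Only the root may sit at v, where the degree bound is weaker.
  Regular : Node → Set
  Regular a = vert a ≡ v → a ≡ root

  ExitTo : Fin s → List (Fin (m G)) → State → Set
  ExitTo x E (y , f) = y ≡ other x f × Exit x E f

  regular⇒back<deg : ∀ a → Regular a → sum (map (ends-at (vert a)) (back a)) < deg G (vert a)
  regular⇒back<deg root _ = deg-v
  regular⇒back<deg (below β) reg = begin-strict
    ends-at (vert (below β)) (incoming (below β)) + 0  ≤⟨ +-monoˡ-≤ 0 (ends-at≤2 _ _) ⟩
    2                                                  <⟨ deg-others _ (λ at-v → case reg at-v of λ ()) ⟩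
    deg G (vert (below β))                             ∎
    where open ≤-Reasoning

  leave-exit : ∀ x E d → sum (map (ends-at x) E) < deg G x → ExitTo x E (leave x E d)
  leave-exit x E d room with leave-spec x E d
  ... | inj₁ (f , eq , exit) rewrite eq = refl , exit
  ... | inj₂ (_ , deg≤) = ⊥-elim (<⇒≱ room deg≤)

  parent-exit : ∀ β → Regular (parent (below β)) →
    ExitTo (vert (parent (below β))) (back (parent (below β))) (state (below β))
  parent-exit top reg = leave-exit v [] (v , e₀) (regular⇒back<deg root reg)
  parent-exit (β ▷ false) reg = leave-exit _ _ _ (regular⇒back<deg (below β) reg)
  parent-exit (β ▷ true) reg with leave-spec x (proj₂ (firstExit (x , e)) ∷ [ e ]) (firstExit (x , e))
    where x = vert (below β) ; e = incoming (below β)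
  ... | inj₁ (f , eq , f∉ , f-at-x) rewrite eq = refl , (λ f∈ → f∉ (there f∈)) , f-at-x
  ... | inj₂ (eq , _) rewrite eq = leave-exit _ _ _ (regular⇒back<deg (below β) reg)

  parent-joins : ∀ {c} → c ≢ root → Regular (parent c) → Joins G (incoming c) (vert (parent c)) (vert c)
  parent-joins {root} c≢root _ = ⊥-elim (c≢root refl)
  parent-joins {below β} _ reg with parent-exit β reg
  ... | y≡ , _ , at = subst (Joins G _ _) (sym y≡) (Joins-other _ _ at)

  incoming-≢-parent : ∀ {c} → parent c ≢ root → Regular (parent c) → incoming c ≢ incoming (parent c)
  incoming-≢-parent {root} p≢root = ⊥-elim (p≢root refl)
  incoming-≢-parent {below top} p≢root = ⊥-elim (p≢root refl)
  incoming-≢-parent {below (β ▷ b)} _ reg eq = proj₁ (proj₂ (parent-exit (β ▷ b) reg)) (here eq)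

  siblings-exits-differ : ∀ β → Regular (below β) → Regular (parent (below β)) →
    vert (parent (below β)) ≢ vert (below β) → vert (below (β ▷ false)) ≢ vert (below β) →
    incoming (below (β ▷ false)) ≢ incoming (below (β ▷ true))
  siblings-exits-differ β reg reg-parent not-loop first-moves
    with leave-spec x (f₀ ∷ [ e ]) (firstExit (x , e))
    where x = vert (below β) ; e = incoming (below β) ; f₀ = incoming (below (β ▷ false))
  ... | inj₁ (f , eq , f∉ , _) = λ f₀≡ → f∉ (here (sym (trans f₀≡ (cong proj₂ eq))))
  ... | inj₂ (_ , deg≤) = ⊥-elim (first-moves (trans first≡ (other-loop x f₀ f₀-loop)))
    where
    x = vert (below β)
    e = incoming (below β)
    f₀ = incoming (below (β ▷ false))
    first≡ : vert (below (β ▷ false)) ≡ other x f₀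
    first≡ = proj₁ (parent-exit (β ▷ false) reg)
    e-once : ends-at x e ≡ 1
    e-once = Joins⇒ends-at≡1 (parent-joins (λ ()) reg-parent) not-loop
    f₀-loop : 2 ≤ ends-at x f₀
    f₀-loop = +-cancelʳ-≤ 1 2 (ends-at x f₀) (begin
      3                                 ≤⟨ deg-others x (λ at-v → case reg at-v of λ ()) ⟩
      deg G x                           ≤⟨ deg≤ ⟩
      ends-at x f₀ + (ends-at x e + 0)  ≡⟨ cong (λ k → ends-at x f₀ + (k + 0)) e-once ⟩
      ends-at x f₀ + 1                  ∎)
      where open ≤-Reasoning

  descent : ∀ a L k → L + k ≤ depth a → (∀ {t} → t < L + k → Regular (ancestor a t)) → Walk G k
  descent a L k L+k≤ reg = record
    { vertex = λ j → vert (ancestor a (L + j))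
    ; edge   = λ j → incoming (ancestor a (suc (L + j)))
    ; joins  = λ {j} j<k → let L+j<L+k = +-monoʳ-< L j<k in
        subst₂ (λ p c → Joins G (incoming (ancestor a (suc (L + j)))) (vert p) (vert c))
          (parent-ancestor (<-≤-trans L+j<L+k L+k≤)) (cong (ancestor a) (sym (+-suc L j)))
          (parent-joins (ancestor-≢-root (<-≤-trans L+j<L+k L+k≤))
                        (subst Regular (sym (parent-ancestor (<-≤-trans L+j<L+k L+k≤))) (reg L+j<L+k)))
    }
    where
    ancestor-≢-root : ∀ {t} → t < depth a → ancestor a (suc t) ≢ root
    ancestor-≢-root t< eq = case trans (sym (depth-ancestor {a} t<)) (cong depth eq) of λ ()

  repeat-in-bfs : FirstRepeat vert (bfs s)
  repeat-in-bfs with first-repeat _≟_ vert (bfs s)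
  ... | inj₂ R = R
  ... | inj₁ injective = ⊥-elim (<⇒≱ (n<2^n s)
          (subst (_≤ s) (length-bfs s) (InjectiveOn⇒length≤ (AllPairs.map proj₂ (bfs-ordered s)) injective)))

  module Collision {n : ℕ} (R : FirstRepeat vert (bfs n)) where

    open FirstRepeat R renaming (before to seen; repeated to N; injective to seen-injective)

    i : Node
    i = proj₁ (find earlier)

    i∈seen : i ∈ seen
    i∈seen = proj₁ (proj₂ (find earlier))

    i∼N : vert i ≡ vert N
    i∼N = proj₂ (proj₂ (find earlier))

    seen-ordered : All (λ a → All (Precedes a) (N ∷ after)) seen × AllPairs Precedes (N ∷ after)
    seen-ordered = AllPairs-++⁻ seen (subst (AllPairs Precedes) split (bfs-ordered n))

    seen-precedes-N : ∀ {a} → a ∈ seen → Precedes a N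
    seen-precedes-N a∈ with All.lookup (proj₁ seen-ordered) a∈
    ... | a≺N ∷ _ = a≺N

    N∈bfs : N ∈ bfs n
    N∈bfs = subst (N ∈_) (sym split) (∈-++⁺ʳ seen (here refl))

    shallower∈seen : ∀ {a} → depth a < depth N → a ∈ seen
    shallower∈seen {a} a<N with ∈-++⁻ seen (subst (a ∈_) split (∈-bfs⁺ n (<⇒≤ (<-≤-trans a<N (∈-bfs⁻ n N∈bfs)))))
    ... | inj₁ a∈seen = a∈seen
    ... | inj₂ (here refl) = ⊥-elim (<-irrefl refl a<N)
    ... | inj₂ (there a∈after) = ⊥-elim (<⇒≱ a<N (proj₁ (All.lookup N≺after a∈after)))
      where
      N≺after : All (Precedes N) after
      N≺after with proj₂ seen-ordered
      ... | N≺ ∷ _ = N≺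

    depth-i≤N : depth i ≤ depth N
    depth-i≤N = proj₁ (seen-precedes-N i∈seen)

    i≢N : i ≢ N
    i≢N = proj₂ (seen-precedes-N i∈seen)

    depth-seen : ∀ {a a′} → a ∈ seen → a′ ∈ seen → vert a ≡ vert a′ → depth a ≡ depth a′
    depth-seen a∈ a′∈ eq = cong depth (seen-injective a∈ a′∈ eq)

    N≢root : 1 ≤ depth N
    N≢root with depth N in eq
    ... | suc _ = s≤s z≤n
    ... | zero = ⊥-elim (i≢N (trans (depth≡0 (n≤0⇒n≡0 (subst (depth i ≤_) eq depth-i≤N))) (sym (depth≡0 eq))))

    regular : ∀ {a} → a ∈ seen → Regular a
    regular a∈ at-v = seen-injective a∈ (shallower∈seen N≢root) at-v

    ancestor-N∈seen : ∀ {t} → t < depth N → ancestor N t ∈ seen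
    ancestor-N∈seen t< = shallower∈seen (subst (_< depth N) (sym (depth-ancestor {N} (<⇒≤ t<))) t<)

    ancestor-i∈seen : ∀ {t} → t ≤ depth i → ancestor i t ∈ seen
    ancestor-i∈seen {t} t≤ with m≤n⇒m<n∨m≡n t≤
    ... | inj₁ t<i = shallower∈seen (subst (_< depth N) (sym (depth-ancestor {i} t≤)) (<-≤-trans t<i depth-i≤N))
    ... | inj₂ refl = subst (_∈ seen) (sym (ancestor-depth i)) i∈seen

    common : Σ ℕ λ L → L ≤ depth i × ancestor i L ≡ ancestor N L ×
               (∀ {t} → L < t → t ≤ depth i → ancestor i t ≢ ancestor N t)
    common = greatest-≤ (λ t → ancestor i t ≟ₙ ancestor N t) (trans (ancestor-0 i) (sym (ancestor-0 N))) (depth i)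

    L : ℕ
    L = proj₁ common

    L≤i : L ≤ depth i
    L≤i = proj₁ (proj₂ common)

    agree : ancestor i L ≡ ancestor N L
    agree = proj₁ (proj₂ (proj₂ common))

    disagree : ∀ {t} → L < t → t ≤ depth i → ancestor i t ≢ ancestor N t
    disagree = proj₂ (proj₂ (proj₂ common))

    L<N : L < depth N
    L<N = ≤∧≢⇒< (≤-trans L≤i depth-i≤N) λ L≡N →
      let L≡i = ≤-antisym L≤i (subst (depth i ≤_) (sym L≡N) depth-i≤N) in
      i≢N (begin
        i               ≡⟨ ancestor-depth i ⟨
        ancestor i (depth i) ≡⟨ cong (ancestor i) L≡i ⟨
        ancestor i L    ≡⟨ agree ⟩
        ancestor N L    ≡⟨ cong (ancestor N) L≡N ⟩
        ancestor N (depth N) ≡⟨ ancestor-depth N ⟩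
        N               ∎)
      where open ≡-Reasoning

    g′ h D : ℕ
    g′ = depth N ∸ suc L
    h = depth i ∸ L
    D = L + g′

    N-depth : suc D ≡ depth N
    N-depth = m+[n∸m]≡n L<N

    i-depth : L + h ≡ depth i
    i-depth = m+[n∸m]≡n L≤i

    2^D≤s : 2 ^ D ≤ s
    2^D≤s = subst (_≤ s) (length-bfs D)
      (InjectiveOn⇒length≤ (AllPairs.map proj₂ (bfs-ordered D)) λ a∈ a′∈ → seen-injective (in-seen a∈) (in-seen a′∈))
      where
      in-seen : ∀ {a} → a ∈ bfs D → a ∈ seen
      in-seen a∈ = shallower∈seen (subst (_ <_) N-depth (s≤s (∈-bfs⁻ D a∈)))

    -- For L = 0 the root's single child forces i to be the root itself.
    h≤D : h ≤ D
    h≤D with m≤n⇒m<n∨m≡n (z≤n {L})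
    ... | inj₁ 0<L = begin
      depth i ∸ L      ≤⟨ ∸-monoˡ-≤ L depth-i≤N ⟩
      depth N ∸ L      ≡⟨ cong (_∸ L) N-depth ⟨
      suc D ∸ L        ≤⟨ ∸-monoʳ-≤ (suc D) 0<L ⟩
      D                ∎
      where open ≤-Reasoning
    ... | inj₂ 0≡L with m≤n⇒m<n∨m≡n (z≤n {depth i})
    ...   | inj₂ 0≡i = ≤-trans (m∸n≤m (depth i) L) (subst (_≤ D) 0≡i z≤n)
    ...   | inj₁ 0<i = ⊥-elim (disagree (subst (_< 1) 0≡L (s≤s z≤n)) 0<i
                                 (trans (ancestor-1 0<i) (sym (ancestor-1 N≢root))))

    stem : Walk G L
    stem = descent N 0 L (<⇒≤ L<N) (λ t<L → regular (ancestor-N∈seen (<-trans t<L L<N)))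

    arc-N : Walk G (suc g′)
    arc-N = descent N L (suc g′) (≤-reflexive N-depth″) (λ {t} t< → regular (ancestor-N∈seen (subst (t <_) N-depth″ t<)))
      where
      N-depth″ : L + suc g′ ≡ depth N
      N-depth″ = trans (+-suc L g′) N-depth

    arc-i : Walk G h
    arc-i = descent i L h (≤-reflexive i-depth) (λ {t} t< → regular (ancestor-i∈seen (<⇒≤ (subst (t <_) i-depth t<))))

    arcs-meet : vertex arc-N (suc g′) ≡ vertex (reverse G arc-i) 0
    arcs-meet = begin
      vert (ancestor N (L + suc g′))   ≡⟨ cong (vert ∘ ancestor N) (trans (+-suc L g′) N-depth) ⟩
      vert (ancestor N (depth N))      ≡⟨ cong vert (ancestor-depth N) ⟩
      vert N                           ≡⟨ i∼N ⟨
      vert i                           ≡⟨ cong vert (ancestor-depth i) ⟨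
      vert (ancestor i (depth i))      ≡⟨ cong (vert ∘ ancestor i) i-depth ⟨
      vert (ancestor i (L + h))        ∎
      where open ≡-Reasoning

    loop : Walk G (suc (g′ + h))
    loop = append G arc-N (reverse G arc-i) arcs-meet

    ancestor-N-apart : ∀ {t t′} → t < depth N → t′ < depth N → vert (ancestor N t) ≡ vert (ancestor N t′) → t ≡ t′
    ancestor-N-apart t< t′< eq = trans (sym (depth-ancestor {N} (<⇒≤ t<)))
      (trans (depth-seen (ancestor-N∈seen t<) (ancestor-N∈seen t′<) eq) (depth-ancestor {N} (<⇒≤ t′<)))

    ancestor-i-apart : ∀ {t t′} → t ≤ depth i → t′ ≤ depth i → vert (ancestor i t) ≡ vert (ancestor i t′) → t ≡ t′
    ancestor-i-apart t≤ t′≤ eq = trans (sym (depth-ancestor {i} t≤))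
      (trans (depth-seen (ancestor-i∈seen t≤) (ancestor-i∈seen t′≤) eq) (depth-ancestor {i} t′≤))

    stem-injective : InjectiveBelow (suc L) (vertex stem)
    stem-injective j≤L j′≤L = ancestor-N-apart (<-≤-trans j≤L L<N) (<-≤-trans j′≤L L<N)

    on-arc-N : ∀ {j} → j < suc g′ → L + j < depth N
    on-arc-N {j} j< = subst (L + j <_) (trans (+-suc L g′) N-depth) (+-monoʳ-< L j<)

    on-arc-i : ∀ j → L + (h ∸ j) ≤ depth i
    on-arc-i j = subst (L + (h ∸ j) ≤_) i-depth (+-monoʳ-≤ L (m∸n≤m h j))

    arc-N-injective : InjectiveBelow (suc g′) (vertex arc-N)
    arc-N-injective j< j′< eq = +-cancelˡ-≡ L _ _ (ancestor-N-apart (on-arc-N j<) (on-arc-N j′<) eq)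

    arc-i-injective : InjectiveBelow h (vertex (reverse G arc-i))
    arc-i-injective {j} {j′} j< j′< eq =
      ∸-cancelˡ-≡ (<⇒≤ j<) (<⇒≤ j′<) (+-cancelˡ-≡ L _ _ (ancestor-i-apart (on-arc-i j) (on-arc-i j′) eq))

    arcs-apart : ∀ {j j′} → j < suc g′ → j′ < h → vertex arc-N j ≢ vertex (reverse G arc-i) j′
    arcs-apart {j} {j′} j< j′< eq = disagree L<t (on-arc-i j′) (begin
      ancestor i t          ≡⟨ same ⟨
      ancestor N (L + j)    ≡⟨ cong (ancestor N) L+j≡t ⟩
      ancestor N t          ∎)
      where
      open ≡-Reasoning
      t = L + (h ∸ j′)
      L<t : L < t
      L<t = subst (_< t) (+-identityʳ L) (+-monoʳ-< L (m<n⇒0<n∸m j′<))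
      same : ancestor N (L + j) ≡ ancestor i t
      same = seen-injective (ancestor-N∈seen (on-arc-N j<)) (ancestor-i∈seen (on-arc-i j′)) eq
      L+j≡t : L + j ≡ t
      L+j≡t = trans (sym (depth-ancestor {N} (<⇒≤ (on-arc-N j<)))) (trans (cong depth same) (depth-ancestor {i} (on-arc-i j′)))

    loop-injective : InjectiveBelow (suc (g′ + h)) (vertex loop)
    loop-injective = append-injective G arc-N (reverse G arc-i) arcs-meet arc-N-injective arc-i-injective arcs-apart

    loop-start : vertex loop 0 ≡ vert (ancestor N L)
    loop-start = trans (splice-< {f = vertex arc-N} {g = vertex (reverse G arc-i)} (0<1+n {g′}))
                       (cong (vert ∘ ancestor N) (+-identityʳ L))

    loop-closed : vertex loop (suc (g′ + h)) ≡ vertex loop 0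
    loop-closed = begin
      vertex loop (suc g′ + h)                       ≡⟨ splice-≥ {f = vertex arc-N} (m≤m+n (suc g′) h) ⟩
      vertex (reverse G arc-i) (suc g′ + h ∸ suc g′) ≡⟨ cong (vertex (reverse G arc-i)) (m+n∸m≡n (suc g′) h) ⟩
      vert (ancestor i (L + (h ∸ h)))                ≡⟨ cong (λ k → vert (ancestor i (L + k))) (n∸n≡0 h) ⟩
      vert (ancestor i (L + 0))                      ≡⟨ cong vert (trans (cong (ancestor i) (+-identityʳ L)) agree) ⟩
      vert (ancestor N L)                            ≡⟨ loop-start ⟨
      vertex loop 0                                  ∎
      where open ≡-Reasoning

    stem-start : vertex stem 0 ≡ v
    stem-start = cong vert (ancestor-0 N)

    stem-end : vertex stem L ≡ vertex loop 0
    stem-end = sym loop-start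

    first-edge : edge loop 0 ≡ incoming (ancestor N (suc L))
    first-edge = trans (splice-< {f = edge arc-N} {g = edge (reverse G arc-i)} (0<1+n {g′}))
                       (cong (λ k → incoming (ancestor N (suc k))) (+-identityʳ L))

    two-edges-on-arc-N : g′ ≡ 1 → edge loop 0 ≢ edge loop 1
    two-edges-on-arc-N g′≡1 eq = incoming-≢-parent {c} parent≢root (regular (subst (_∈ seen) (sym parent-c) c′∈seen))
      (trans (sym second-edge) (trans (sym eq) (trans first-edge (cong incoming (sym parent-c)))))
      where
      c = ancestor N (suc (suc L))
      1+L<N : suc L < depth N
      1+L<N = subst (suc L <_) (trans (cong (λ k → suc (L + k)) (sym g′≡1)) N-depth) (s≤s (≤-reflexive (+-comm 1 L)))
      parent-c : parent c ≡ ancestor N (suc L)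
      parent-c = parent-ancestor 1+L<N
      c′∈seen : ancestor N (suc L) ∈ seen
      c′∈seen = ancestor-N∈seen 1+L<N
      parent≢root : parent c ≢ root
      parent≢root p≡root = case trans (sym (depth-ancestor {N} (<⇒≤ 1+L<N))) (cong depth (trans (sym parent-c) p≡root)) of λ ()
      second-edge : edge loop 1 ≡ incoming c
      second-edge = trans (splice-< {f = edge arc-N} {g = edge (reverse G arc-i)} (subst (1 <_) (cong suc (sym g′≡1)) ≤-refl))
                          (cong (λ k → incoming (ancestor N (suc k))) (+-comm L 1))

    children-edges-differ : ∀ β → below β ∈ seen → vert (below (β ▷ false)) ≢ vert (below β) →
      incoming (below (β ▷ false)) ≢ incoming (below (β ▷ true))
    children-edges-differ β β∈seen = siblings-exits-differ β (regular β∈seen) (regular parent∈seen) not-loop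
      where
      parent∈seen : parent (below β) ∈ seen
      parent∈seen = shallower∈seen (subst (_< depth N) (sym (depth-parent (below β)))
                                          (<-≤-trans (n<1+n (height β)) (proj₁ (seen-precedes-N β∈seen))))
      not-loop : vert (parent (below β)) ≢ vert (below β)
      not-loop e = <-irrefl (trans (sym (depth-parent (below β))) (depth-seen parent∈seen β∈seen e)) (n<1+n (height β))

    fork-edges-differ : ∀ {a a′} → parent a ≡ parent a′ → depth a ≡ depth a′ → a ≢ a′ → parent a ∈ seen →
      vert a ≡ vert a′ → vert a′ ≢ vert (parent a) → incoming a ≢ incoming a′
    fork-edges-differ same-parent same-depth a≢a′ p∈seen same-vert a′-moves
      with siblings same-parent same-depth a≢a′
    ... | β , refl , inj₁ (refl , refl) = children-edges-differ β p∈seen (a′-moves ∘ trans (sym same-vert))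
    ... | β , refl , inj₂ (refl , refl) = children-edges-differ β p∈seen a′-moves ∘ sym

    two-edges-at-fork : g′ ≡ 0 → h ≡ 1 → edge loop 0 ≢ edge loop 1
    two-edges-at-fork g′≡0 h≡1 eq =
      fork-edges-differ same-parent same-depth a≢a′ (subst (_∈ seen) (sym parent-a) (ancestor-N∈seen L<N))
        (trans (cong vert a≡N) (sym (trans (cong vert a′≡i) i∼N))) a′-moves
        (trans (sym first-edge) (trans eq second-edge))
      where
      a = ancestor N (suc L)
      a′ = ancestor i (suc L)
      N-depth′ : suc L ≡ depth N
      N-depth′ = trans (cong suc (sym (+-identityʳ L))) (trans (cong (λ k → suc (L + k)) (sym g′≡0)) N-depth)
      i-depth′ : suc L ≡ depth i
      i-depth′ = trans (+-comm 1 L) (trans (cong (L +_) (sym h≡1)) i-depth)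
      a≡N : a ≡ N
      a≡N = trans (cong (ancestor N) N-depth′) (ancestor-depth N)
      a′≡i : a′ ≡ i
      a′≡i = trans (cong (ancestor i) i-depth′) (ancestor-depth i)
      parent-a : parent a ≡ ancestor N L
      parent-a = parent-ancestor (subst (L <_) N-depth′ ≤-refl)
      same-parent : parent a ≡ parent a′
      same-parent = trans parent-a (trans (sym agree) (sym (parent-ancestor (subst (L <_) i-depth′ ≤-refl))))
      same-depth : depth a ≡ depth a′
      same-depth = trans (cong depth a≡N) (trans (sym N-depth′) (trans i-depth′ (cong depth (sym a′≡i))))
      a≢a′ : a ≢ a′
      a≢a′ e = i≢N (trans (sym a′≡i) (trans (sym e) a≡N))
      a′-moves : vert a′ ≢ vert (parent a)
      a′-moves e = <-irrefl (trans (sym (depth-ancestor {N} (<⇒≤ L<N)))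
                                   (trans (sym (depth-seen i∈seen (ancestor-N∈seen L<N) i∼parent)) (sym i-depth′)))
                            (n<1+n L)
        where
        i∼parent : vert i ≡ vert (ancestor N L)
        i∼parent = trans (sym (cong vert a′≡i)) (trans e (cong vert parent-a))
      second-edge : edge loop 1 ≡ incoming a′
      second-edge = trans (splice-≥ {f = edge arc-N} {g = edge (reverse G arc-i)} (subst (_≤ 1) (cong suc (sym g′≡0)) ≤-refl))
        (trans (cong₂ (λ g″ h′ → incoming (ancestor i (suc (L + (h′ ∸ suc (1 ∸ suc g″)))))) g′≡0 h≡1)
               (cong (λ k → incoming (ancestor i (suc k))) (+-identityʳ L)))

    loop-two-edges : g′ + h ≡ 1 → edge loop 0 ≢ edge loop 1
    loop-two-edges g′+h≡1 with m+n≡1 g′+h≡1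
    ... | inj₁ (g′≡0 , h≡1) = two-edges-at-fork g′≡0 h≡1
    ... | inj₂ (g′≡1 , _) = two-edges-on-arc-N g′≡1

    size : suc L + suc (g′ + h) ≤ 2 + (D + D)
    size = begin
      suc L + suc (g′ + h)      ≡⟨ cong suc (+-suc L (g′ + h)) ⟩
      2 + (L + (g′ + h))        ≡⟨ cong (2 +_) (+-assoc L g′ h) ⟨
      2 + (D + h)               ≤⟨ +-monoʳ-≤ 2 (+-monoʳ-≤ D h≤D) ⟩
      2 + (D + D)               ∎
      where open ≤-Reasoning

claim1 : (s : ℕ) → 2 ≤ s → (G : Multigraph s) → (v : Fin s) →
    1 ≤ deg G v → ((u : Fin s) → u ≢ v → 3 ≤ deg G u) →
    Σ ℕ λ k' → Σ ℕ λ ℓ' →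
    Σ (Fin (suc k') → Fin s) λ p → Σ (Fin (suc ℓ') → Fin s) λ c →
    IsPath G k' p × IsCycle G ℓ' c ×
    p zero ≡ v × p (fromℕ k') ≡ c zero ×
    2 ^ (suc k' + suc ℓ') ≤ s ^ 4
claim1 s 2≤s G v deg-v deg-others =
  L , g′ + h , vertex stem ∘ toℕ , vertex loop ∘ toℕ ,
  walk⇒IsPath G stem stem-injective ,
  closed-walk⇒IsCycle G loop loop-closed loop-injective loop-two-edges ,
  stem-start ,
  trans (cong (vertex stem) (toℕ-fromℕ L)) stem-end ,
  2^≤s^4 {D = D} 2≤s 2^D≤s size
  where
  open Exploration G v deg-v deg-others
  open Collision {s} repeat-in-bfs
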